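{- Let $G=H_{n,p}$ with $\theta(G)=1$, and suppose $G$ is $S$-magic with $S$-magic constant $c$, where $S=\{1,\dots,np+1\}\setminus\{a\}$ for some $a\in\{1,\dots,np\}$. Then $$\frac{n^2p+n+1}{2}(p-1)\le c\le \frac{n^2p+3n-1}{2}(p-1).$$
   Context: $H_{n,p}$ denotes the complete multipartite graph with $p$ parts each having exactly $n$ vertices. For a finite set $S$ of positive integers with $|S|=|V(G)|$, a graph $G$ is $S$-magic if there is a bijection $f:V(G)\to S$ and a constant $c$ (the $S$-magic constant) with $\sum_{v\in N(u)} f(v)=c$ for every vertex $u$, where $N(u)$ is the set of neighbours of $u$. Let $\alpha(S)=\max S$ and $i(G)=\min \alpha(S)$ over all $S$ for which $G$ is $S$-magic; the distance magic index is $\theta(G)=i(G)-|V(G)|$. -}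

module Defs where

open import Data.Nat using (ℕ; _+_; _*_; _≤_)
open import Data.Fin using (Fin; _≟_)
open import Data.List using (List; map; filter; concatMap; allFin)
open import Data.Nat.ListAction using (sum)
open import Data.Product using (_×_; _,_; proj₁; ∃)
open import Relation.Nullary using (¬_; ¬?)
open import Relation.Binary.PropositionalEquality using (_≡_)
open import Function.Definitions using (Injective)

-- Vertices of H_{n,p}: (part index, index inside the part).
V : ℕ → ℕ → Set
V n p = Fin p × Fin n

vertices : (n p : ℕ) → List (V n p)
vertices n p = concatMap (λ i → map (i ,_) (allFin n)) (allFin p)

N : (n p : ℕ) → V n p → List (V n p)
N n p u = filter (λ v → ¬? (proj₁ u ≟ proj₁ v)) (vertices n p)

nbrSum : (n p : ℕ) → (V n p → ℕ) → V n p → ℕ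
nbrSum n p f u = sum (map f (N n p u))

HasMagicConstant : (n p : ℕ) → (V n p → ℕ) → ℕ → Set
HasMagicConstant n p f c = ∀ u → nbrSum n p f u ≡ c

-- f : V → S is a bijection onto a set S of positive integers (S = image of f)
-- and H_{n,p} is S-magic via f.
IsDistanceMagicLabelling : (n p : ℕ) → (V n p → ℕ) → Set
IsDistanceMagicLabelling n p f =
  Injective _≡_ _≡_ f × (∀ v → 1 ≤ f v) × ∃ (λ c → HasMagicConstant n p f c)

-- i(H_{n,p}) ≤ m : H_{n,p} is S-magic for some S with max S ≤ m.
IndexAtMost : (n p m : ℕ) → Set
IndexAtMost n p m =
  ∃ (λ (f : V n p → ℕ) → IsDistanceMagicLabelling n p f × (∀ v → f v ≤ m))

-- θ(H_{n,p}) = 1, i.e. i(H_{n,p}) = np + 1 (minimum of max S equals np+1).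
ThetaIsOne : (n p : ℕ) → Set
ThetaIsOne n p = IndexAtMost n p (n * p + 1) × ¬ IndexAtMost n p (n * p)

-- In H_{n,p} the neighbourhood of a vertex is everything outside its own part, so the
-- neighbour sum of u is the total label sum minus the sum of u's part.  A magic labelling
-- therefore has all part sums equal to some w, with total p·w and constant c = (p − 1)·w.
-- The labels are {1, …, np+1} without a, so 2a + 2pw = (np+1)(np+2).  If a were 1,
-- lowering every label by one would give a magic labelling by {1, …, np}, contradicting
-- θ = 1; hence 2 ≤ a ≤ np, which pins 2w between n²p + n + 1 and n²p + 3n − 1.

module Submission where

open import Data.Nat using (ℕ; zero; suc; _+_; _*_; _∸_; _≤_; s≤s; z≤n; z<s)
open import Data.Nat.Properties
open import Data.Nat.ListAction using (sum)
open import Data.Nat.ListAction.Properties using (sum-++; sum-↭)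
open import Data.Nat.Tactic.RingSolver using (solve-∀)
open import Data.Fin using (Fin; fromℕ<) renaming (_≟_ to _≟ᶠ_)
open import Data.List using (List; []; _∷_; _++_; map; filter; concatMap; allFin; length; downFrom; cartesianProduct)
open import Data.List.Properties using (filter-all; filter-none; filter-accept; filter-reject; filter-++; map-++; length-map; length-tabulate)
import Data.List.Relation.Unary.All as All
open import Data.List.Relation.Unary.All.Properties using () renaming (map⁺ to All-map⁺)
open import Data.List.Relation.Unary.Any using (here; there)
open import Data.List.Relation.Unary.AllPairs using (_∷_)
open import Data.List.Relation.Unary.Unique.Propositional using (Unique)
open import Data.List.Relation.Unary.Unique.Propositional.Properties using (cartesianProduct⁺; allFin⁺; downFrom⁺) renaming (map⁺ to Unique-map⁺)
open import Data.List.Membership.Propositional using (_∈_)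
open import Data.List.Membership.Propositional.Properties using (∈-map⁺; ∈-map⁻; ∈-allFin; ∈-cartesianProduct⁺; ∈-downFrom⁺; ∈-downFrom⁻)
open import Data.List.Membership.Propositional.Properties.WithK using (unique∧set⇒bag)
open import Data.List.Relation.Binary.BagAndSetEquality using (∼bag⇒↭)
open import Data.Product using (_×_; _,_; proj₁; proj₂; ∃)
open import Function.Bundles using (_⇔_; mk⇔)
open import Function.Definitions using (Injective)
import Function.Properties.Equivalence as ⇔
open import Relation.Binary.Definitions using (DecidableEquality)
open import Relation.Binary.PropositionalEquality
open import Relation.Nullary using (¬_; ¬?; Dec; yes; no)
open import Defs

module _ {A : Set} (_≟_ : DecidableEquality A) (h : A → ℕ) where

  sum-map-filter-≢ : ∀ {x} xs → Unique xs → x ∈ xs →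
    sum (map h (filter (λ y → ¬? (x ≟ y)) xs)) + h x ≡ sum (map h xs)
  sum-map-filter-≢ {x} (x ∷ ys) (x∉ys ∷ _) (here refl) = begin
    sum (map h (filter Q (x ∷ ys))) + h x ≡⟨ cong (λ zs → sum (map h zs) + h x) (filter-reject Q (λ x≢x → x≢x refl)) ⟩
    sum (map h (filter Q ys)) + h x       ≡⟨ cong (λ zs → sum (map h zs) + h x) (filter-all Q x∉ys) ⟩
    sum (map h ys) + h x                  ≡⟨ +-comm _ (h x) ⟩
    h x + sum (map h ys)                  ∎
    where
    open ≡-Reasoning
    Q = λ y → ¬? (x ≟ y)
  sum-map-filter-≢ {x} (y ∷ ys) (y∉ys ∷ uys) (there x∈ys) = begin
    sum (map h (filter Q (y ∷ ys))) + h x   ≡⟨ cong (λ zs → sum (map h zs) + h x) (filter-accept Q x≢y) ⟩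
    h y + sum (map h (filter Q ys)) + h x   ≡⟨ +-assoc (h y) _ (h x) ⟩
    h y + (sum (map h (filter Q ys)) + h x) ≡⟨ cong (h y +_) (sum-map-filter-≢ ys uys x∈ys) ⟩
    h y + sum (map h ys)                    ∎
    where
    open ≡-Reasoning
    Q = λ y → ¬? (x ≟ y)
    x≢y = ≢-sym (All.lookup y∉ys x∈ys)

module _ {A : Set} where

  sum-map-const : ∀ {h : A → ℕ} {w} → (∀ x → h x ≡ w) → ∀ xs → sum (map h xs) ≡ length xs * w
  sum-map-const h≡w [] = refl
  sum-map-const h≡w (x ∷ xs) = cong₂ _+_ (h≡w x) (sum-map-const h≡w xs)

  sum-map-∸1 : ∀ {h : A → ℕ} → (∀ x → 1 ≤ h x) → ∀ xs →
    sum (map (λ x → h x ∸ 1) xs) + length xs ≡ sum (map h xs)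
  sum-map-∸1 h≥1 [] = refl
  sum-map-∸1 {h} h≥1 (x ∷ xs) = begin
    h x ∸ 1 + sum (map (λ y → h y ∸ 1) xs) + suc (length xs)   ≡⟨ reassoc (h x ∸ 1) _ (length xs) ⟩
    (h x ∸ 1 + 1) + (sum (map (λ y → h y ∸ 1) xs) + length xs) ≡⟨ cong₂ _+_ (m∸n+n≡m (h≥1 x)) (sum-map-∸1 h≥1 xs) ⟩
    h x + sum (map h xs)                                       ∎
    where
    open ≡-Reasoning
    reassoc : ∀ a s l → a + s + suc l ≡ (a + 1) + (s + l)
    reassoc = solve-∀

labels : ℕ → List ℕ
labels M = map suc (downFrom M)

∈-labels⇔ : ∀ {M x} → x ∈ labels M ⇔ (1 ≤ x × x ≤ M)
∈-labels⇔ {M} = mk⇔ to from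
  where
  to : ∀ {x} → x ∈ labels M → 1 ≤ x × x ≤ M
  to x∈ with ∈-map⁻ suc x∈
  ... | i , i∈ , refl = s≤s z≤n , ∈-downFrom⁻ i∈
  from : ∀ {x} → 1 ≤ x × x ≤ M → x ∈ labels M
  from {suc i} (_ , i<M) = ∈-map⁺ suc (∈-downFrom⁺ i<M)

2*sum-labels : ∀ M → 2 * sum (labels M) ≡ M * suc M
2*sum-labels zero = refl
2*sum-labels (suc M) = begin
  2 * (suc M + sum (labels M))   ≡⟨ *-distribˡ-+ 2 (suc M) _ ⟩
  2 * suc M + 2 * sum (labels M) ≡⟨ cong (2 * suc M +_) (2*sum-labels M) ⟩
  2 * suc M + M * suc M          ≡⟨ *-distribʳ-+ (suc M) 2 M ⟨
  suc (suc M) * suc M            ≡⟨ *-comm (suc (suc M)) (suc M) ⟩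
  suc M * suc (suc M)            ∎
  where open ≡-Reasoning

2*sum≡triangular : ∀ {M} {xs : List ℕ} → Unique xs → (∀ {x} → x ∈ xs ⇔ (1 ≤ x × x ≤ M)) →
  2 * sum xs ≡ M * suc M
2*sum≡triangular {M} {xs} uxs ∈xs⇔ = begin
  2 * sum xs         ≡⟨ cong (2 *_) (sum-↭ (∼bag⇒↭ xs∼labels)) ⟩
  2 * sum (labels M) ≡⟨ 2*sum-labels M ⟩
  M * suc M          ∎
  where
  open ≡-Reasoning
  xs∼labels = unique∧set⇒bag uxs (Unique-map⁺ suc-injective (downFrom⁺ M))
                (⇔.trans ∈xs⇔ (⇔.sym ∈-labels⇔))

block : (n : ℕ) {p : ℕ} → Fin p → List (V n p)
block n i = map (i ,_) (allFin n)

partSum : ∀ {n p} → (V n p → ℕ) → Fin p → ℕ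
partSum {n} g i = sum (map g (block n i))

total : ∀ {n p} → (V n p → ℕ) → ℕ
total {n} {p} g = sum (map g (vertices n p))

vertices≡cartesianProduct : ∀ n p → vertices n p ≡ cartesianProduct (allFin p) (allFin n)
vertices≡cartesianProduct n p = go (allFin p)
  where
  go : (is : List (Fin p)) → concatMap (block n) is ≡ cartesianProduct is (allFin n)
  go [] = refl
  go (i ∷ is) = cong (block n i ++_) (go is)

vertices-unique : ∀ n p → Unique (vertices n p)
vertices-unique n p rewrite vertices≡cartesianProduct n p = cartesianProduct⁺ (allFin⁺ p) (allFin⁺ n)

∈-vertices : ∀ {n p} (v : V n p) → v ∈ vertices n p
∈-vertices {n} {p} (i , j) rewrite vertices≡cartesianProduct n p =
  ∈-cartesianProduct⁺ (∈-allFin i) (∈-allFin j)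

length-block : ∀ n {p} (i : Fin p) → length (block n i) ≡ n
length-block n i = trans (length-map (i ,_) (allFin n)) (length-tabulate {n = n} (λ j → j))

module _ {n p : ℕ} where

  outside : (i : Fin p) (v : V n p) → Dec (i ≢ proj₁ v)
  outside i v = ¬? (i ≟ᶠ proj₁ v)

  filter-outside-block-≡ : ∀ i → filter (outside i) (block n i) ≡ []
  filter-outside-block-≡ i =
    filter-none (outside i) (All-map⁺ (All.universal (λ _ i≢i → i≢i refl) (allFin n)))

  filter-outside-block-≢ : ∀ {i k} → i ≢ k → filter (outside i) (block n k) ≡ block n k
  filter-outside-block-≢ {i} i≢k =
    filter-all (outside i) (All-map⁺ (All.universal (λ _ → i≢k) (allFin n)))

  filter-outside-concatMap-block : ∀ i is →
    filter (outside i) (concatMap (block n) is) ≡ concatMap (block n) (filter (λ k → ¬? (i ≟ᶠ k)) is)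
  filter-outside-concatMap-block i [] = refl
  filter-outside-concatMap-block i (k ∷ is) = begin
    filter (outside i) (block n k ++ concatMap (block n) is)
      ≡⟨ filter-++ (outside i) (block n k) _ ⟩
    filter (outside i) (block n k) ++ filter (outside i) (concatMap (block n) is)
      ≡⟨ cong (filter (outside i) (block n k) ++_) (filter-outside-concatMap-block i is) ⟩
    filter (outside i) (block n k) ++ concatMap (block n) (filter Q is)
      ≡⟨ split (i ≟ᶠ k) ⟩
    concatMap (block n) (filter Q (k ∷ is)) ∎
    where
    open ≡-Reasoning
    Q = λ k → ¬? (i ≟ᶠ k)
    split : Dec (i ≡ k) →
      filter (outside i) (block n k) ++ concatMap (block n) (filter Q is) ≡ concatMap (block n) (filter Q (k ∷ is))
    split (yes refl) = begin
      filter (outside i) (block n i) ++ concatMap (block n) (filter Q is)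
        ≡⟨ cong (_++ concatMap (block n) (filter Q is)) (filter-outside-block-≡ i) ⟩
      concatMap (block n) (filter Q is)
        ≡⟨ cong (concatMap (block n)) (filter-reject Q (λ i≢i → i≢i refl)) ⟨
      concatMap (block n) (filter Q (i ∷ is)) ∎
    split (no i≢k) = begin
      filter (outside i) (block n k) ++ concatMap (block n) (filter Q is)
        ≡⟨ cong (_++ concatMap (block n) (filter Q is)) (filter-outside-block-≢ i≢k) ⟩
      block n k ++ concatMap (block n) (filter Q is)
        ≡⟨ cong (concatMap (block n)) (filter-accept Q i≢k) ⟨
      concatMap (block n) (filter Q (k ∷ is)) ∎

  sum-map-concatMap-block : ∀ (g : V n p → ℕ) is →
    sum (map g (concatMap (block n) is)) ≡ sum (map (partSum g) is)
  sum-map-concatMap-block g [] = refl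
  sum-map-concatMap-block g (k ∷ is) = begin
    sum (map g (block n k ++ concatMap (block n) is))            ≡⟨ cong sum (map-++ g (block n k) _) ⟩
    sum (map g (block n k) ++ map g (concatMap (block n) is))    ≡⟨ sum-++ (map g (block n k)) _ ⟩
    partSum g k + sum (map g (concatMap (block n) is))           ≡⟨ cong (partSum g k +_) (sum-map-concatMap-block g is) ⟩
    partSum g k + sum (map (partSum g) is)                       ∎
    where open ≡-Reasoning

  total≡sum-partSum : ∀ (g : V n p → ℕ) → total g ≡ sum (map (partSum g) (allFin p))
  total≡sum-partSum g = sum-map-concatMap-block g (allFin p)

  nbrSum+partSum≡total : ∀ (g : V n p → ℕ) u → nbrSum n p g u + partSum g (proj₁ u) ≡ total g
  nbrSum+partSum≡total g (i , j) = begin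
    nbrSum n p g (i , j) + partSum g i
      ≡⟨ cong (λ vs → sum (map g vs) + partSum g i) (filter-outside-concatMap-block i (allFin p)) ⟩
    sum (map g (concatMap (block n) (filter (λ k → ¬? (i ≟ᶠ k)) (allFin p)))) + partSum g i
      ≡⟨ cong (_+ partSum g i) (sum-map-concatMap-block g (filter (λ k → ¬? (i ≟ᶠ k)) (allFin p))) ⟩
    sum (map (partSum g) (filter (λ k → ¬? (i ≟ᶠ k)) (allFin p))) + partSum g i
      ≡⟨ sum-map-filter-≢ _≟ᶠ_ (partSum g) (allFin p) (allFin⁺ p) (∈-allFin i) ⟩
    sum (map (partSum g) (allFin p))
      ≡⟨ total≡sum-partSum g ⟨
    total g ∎
    where open ≡-Reasoning

  c+partSum≡total : ∀ {g : V n p → ℕ} {c} → Fin n → HasMagicConstant n p g c →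
    ∀ i → c + partSum g i ≡ total g
  c+partSum≡total {g} j mag i =
    trans (cong (_+ partSum g i) (sym (mag (i , j)))) (nbrSum+partSum≡total g (i , j))

  partSum≡total∸c : ∀ {g : V n p → ℕ} {c} → Fin n → HasMagicConstant n p g c →
    ∀ i → partSum g i ≡ total g ∸ c
  partSum≡total∸c {g} {c} j mag i =
    trans (sym (m+n∸m≡n c (partSum g i))) (cong (_∸ c) (c+partSum≡total j mag i))

  partSum-constant⇒magic : ∀ {g : V n p → ℕ} {w} → (∀ i → partSum g i ≡ w) →
    HasMagicConstant n p g (total g ∸ w)
  partSum-constant⇒magic {g} {w} partSum≡w (i , j) = begin
    nbrSum n p g (i , j)                    ≡⟨ m+n∸n≡m _ w ⟨
    nbrSum n p g (i , j) + w ∸ w            ≡⟨ cong (λ s → nbrSum n p g (i , j) + s ∸ w) (partSum≡w i) ⟨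
    nbrSum n p g (i , j) + partSum g i ∸ w  ≡⟨ cong (_∸ w) (nbrSum+partSum≡total g (i , j)) ⟩
    total g ∸ w                             ∎
    where open ≡-Reasoning

  partSum-constant⇒total≡p*w : ∀ {g : V n p → ℕ} {w} → (∀ i → partSum g i ≡ w) → total g ≡ p * w
  partSum-constant⇒total≡p*w {g} {w} partSum≡w = begin
    total g                          ≡⟨ total≡sum-partSum g ⟩
    sum (map (partSum g) (allFin p)) ≡⟨ sum-map-const partSum≡w (allFin p) ⟩
    length (allFin p) * w            ≡⟨ cong (_* w) (length-tabulate {n = p} (λ i → i)) ⟩
    p * w                            ∎
    where open ≡-Reasoning

  partSum-∸1 : ∀ {g : V n p → ℕ} → (∀ v → 1 ≤ g v) →
    ∀ i → partSum (λ v → g v ∸ 1) i + n ≡ partSum g i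
  partSum-∸1 {g} g≥1 i = begin
    partSum (λ v → g v ∸ 1) i + n                  ≡⟨ cong (partSum (λ v → g v ∸ 1) i +_) (length-block n i) ⟨
    partSum (λ v → g v ∸ 1) i + length (block n i) ≡⟨ sum-map-∸1 g≥1 (block n i) ⟩
    partSum g i                                    ∎
    where open ≡-Reasoning

  magic-∸1 : ∀ {f : V n p → ℕ} {c} → Fin n → (∀ v → 1 ≤ f v) → HasMagicConstant n p f c →
    ∃ λ d → HasMagicConstant n p (λ v → f v ∸ 1) d
  magic-∸1 {f} {c} j f≥1 mag = _ , partSum-constant⇒magic partSum≡
    where
    partSum≡ : ∀ i → partSum (λ v → f v ∸ 1) i ≡ total f ∸ c ∸ n
    partSum≡ i = begin
      partSum (λ v → f v ∸ 1) i          ≡⟨ m+n∸n≡m _ n ⟨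
      partSum (λ v → f v ∸ 1) i + n ∸ n  ≡⟨ cong (_∸ n) (partSum-∸1 f≥1 i) ⟩
      partSum f i ∸ n                    ≡⟨ cong (_∸ n) (partSum≡total∸c j mag i) ⟩
      total f ∸ c ∸ n                    ∎
      where open ≡-Reasoning

  indexAtMost-∸1 : ∀ {m} {f : V n p → ℕ} {c} → Fin n → Injective _≡_ _≡_ f →
    (∀ v → 2 ≤ f v × f v ≤ m + 1) → HasMagicConstant n p f c → IndexAtMost n p m
  indexAtMost-∸1 {m} {f} j inj bounds mag =
    (λ v → f v ∸ 1) , (injective , (λ v → ∸-monoˡ-≤ 1 (proj₁ (bounds v))) , magic-∸1 j f≥1 mag) , ≤m
    where
    f≥1 : ∀ v → 1 ≤ f v
    f≥1 v = ≤-trans (n≤1+n 1) (proj₁ (bounds v))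
    injective : Injective _≡_ _≡_ (λ v → f v ∸ 1)
    injective {x} {y} eq = inj (∸-cancelʳ-≡ (f≥1 x) (f≥1 y) eq)
    ≤m : ∀ v → f v ∸ 1 ≤ m
    ≤m v = subst (f v ∸ 1 ≤_) (m+n∸n≡m m 1) (∸-monoˡ-≤ 1 (proj₂ (bounds v)))

  2*[a+total]≡triangular : ∀ {M a} {f : V n p → ℕ} → 1 ≤ a → a ≤ M → Injective _≡_ _≡_ f →
    (∀ v → 1 ≤ f v × f v ≤ M × f v ≢ a) →
    (∀ s → 1 ≤ s → s ≤ M → s ≢ a → ∃ (λ v → f v ≡ s)) →
    2 * (a + total f) ≡ M * suc M
  2*[a+total]≡triangular {M} {a} {f} a≥1 a≤M inj range onto = 2*sum≡triangular unique (mk⇔ to from)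
    where
    unique : Unique (a ∷ map f (vertices n p))
    unique = All-map⁺ (All.universal (λ v a≡fv → proj₂ (proj₂ (range v)) (sym a≡fv)) (vertices n p))
           ∷ Unique-map⁺ inj (vertices-unique n p)
    to : ∀ {x} → x ∈ a ∷ map f (vertices n p) → 1 ≤ x × x ≤ M
    to (here refl) = a≥1 , a≤M
    to (there x∈) with ∈-map⁻ f x∈
    ... | v , _ , refl = proj₁ (range v) , proj₁ (proj₂ (range v))
    from : ∀ {x} → 1 ≤ x × x ≤ M → x ∈ a ∷ map f (vertices n p)
    from {x} (x≥1 , x≤M) with x ≟ a
    ... | yes refl = here refl
    ... | no x≢a with onto x x≥1 x≤M x≢a
    ...   | v , refl = there (∈-map⁺ f (∈-vertices v))

missingLabel≥2 : ∀ {n p a} {f : V n p → ℕ} {c} → ¬ IndexAtMost n p (n * p) → Fin n → 1 ≤ a →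
  Injective _≡_ _≡_ f → (∀ v → 1 ≤ f v × f v ≤ n * p + 1 × f v ≢ a) → HasMagicConstant n p f c → 2 ≤ a
missingLabel≥2 {f = f} ¬index≤np j a≥1 inj range mag =
  ≤∧≢⇒< a≥1 λ 1≡a → ¬index≤np (indexAtMost-∸1 j inj (labels≥2 1≡a) mag)
  where
  labels≥2 : 1 ≡ _ → ∀ v → 2 ≤ f v × f v ≤ _
  labels≥2 1≡a v = ≤∧≢⇒< (proj₁ (range v)) (λ 1≡fv → proj₂ (proj₂ (range v)) (trans (sym 1≡fv) 1≡a))
                 , proj₁ (proj₂ (range v))

c+w≡p*w⇒c≡[p∸1]*w : ∀ {c w} p → c + w ≡ p * w → c ≡ (p ∸ 1) * w
c+w≡p*w⇒c≡[p∸1]*w {c} {w} p c+w≡p*w = begin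
  c                 ≡⟨ m+n∸n≡m c w ⟨
  c + w ∸ w         ≡⟨ cong (_∸ w) c+w≡p*w ⟩
  p * w ∸ w         ≡⟨ cong (p * w ∸_) (*-identityˡ w) ⟨
  p * w ∸ 1 * w     ≡⟨ *-distribʳ-∸ w p 1 ⟨
  (p ∸ 1) * w       ∎
  where open ≡-Reasoning

2w-bounds : ∀ n p a w → 2 ≤ a → a ≤ n * p → 2 * (a + p * w) ≡ (n * p + 1) * suc (n * p + 1) →
  n * n * p + n + 1 ≤ 2 * w × 2 * w ≤ n * n * p + 3 * n ∸ 1
2w-bounds n p a w 2≤a a≤np labelSum = lower , upper
  where
  open ≤-Reasoning
  expand : ∀ a p w → 2 * (a + p * w) ≡ 2 * a + p * (2 * w)
  expand = solve-∀
  lowerGap : ∀ n p → 2 + (2 * (n * p) + p * (n * n * p + n)) ≡ (n * p + 1) * suc (n * p + 1)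
  lowerGap = solve-∀
  upperGap : ∀ n p → 2 + (n * p + 1) * suc (n * p + 1) ≡ 2 * 2 + p * (n * n * p + 3 * n)
  upperGap = solve-∀
  lower : n * n * p + n + 1 ≤ 2 * w
  lower = subst (_≤ 2 * w) (+-comm 1 (n * n * p + n)) (≰⇒> λ 2w≤ → <-irrefl labelSum (begin-strict
    2 * (a + p * w)                           ≡⟨ expand a p w ⟩
    2 * a + p * (2 * w)                       ≤⟨ +-mono-≤ (*-monoʳ-≤ 2 a≤np) (*-monoʳ-≤ p 2w≤) ⟩
    2 * (n * p) + p * (n * n * p + n)         <⟨ m<n+m _ {2} z<s ⟩
    2 + (2 * (n * p) + p * (n * n * p + n))   ≡⟨ lowerGap n p ⟩
    (n * p + 1) * suc (n * p + 1)             ∎))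
  upper : 2 * w ≤ n * n * p + 3 * n ∸ 1
  upper = ∸-monoˡ-≤ 1 (≰⇒> λ 2w≥ → <-irrefl (sym labelSum) (begin-strict
    (n * p + 1) * suc (n * p + 1)             <⟨ m<n+m _ {2} z<s ⟩
    2 + (n * p + 1) * suc (n * p + 1)         ≡⟨ upperGap n p ⟩
    2 * 2 + p * (n * n * p + 3 * n)           ≤⟨ +-mono-≤ (*-monoʳ-≤ 2 2≤a) (*-monoʳ-≤ p 2w≥) ⟩
    2 * a + p * (2 * w)                       ≡⟨ expand a p w ⟨
    2 * (a + p * w)                           ∎))

magicConstant-bounds : ∀ n p a w c → 2 ≤ a → a ≤ n * p →
  2 * (a + p * w) ≡ (n * p + 1) * suc (n * p + 1) → c ≡ (p ∸ 1) * w →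
  ((n * n * p + n + 1) * (p ∸ 1) ≤ 2 * c) × (2 * c ≤ (n * n * p + 3 * n ∸ 1) * (p ∸ 1))
magicConstant-bounds n p a w _ 2≤a a≤np labelSum refl with 2w-bounds n p a w 2≤a a≤np labelSum
... | lower , upper =
  subst ((n * n * p + n + 1) * (p ∸ 1) ≤_) (reorder (p ∸ 1) w) (*-monoˡ-≤ (p ∸ 1) lower) ,
  subst (_≤ (n * n * p + 3 * n ∸ 1) * (p ∸ 1)) (reorder (p ∸ 1) w) (*-monoˡ-≤ (p ∸ 1) upper)
  where
  reorder : ∀ q w → 2 * w * q ≡ 2 * (q * w)
  reorder = solve-∀

mainTheorem6 : (n p : ℕ) → 1 ≤ n → 1 ≤ p → ThetaIsOne n p →
    (a : ℕ) → 1 ≤ a → a ≤ n * p →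
    (f : V n p → ℕ) → (c : ℕ) →
    Injective _≡_ _≡_ f →
    (∀ v → 1 ≤ f v × f v ≤ n * p + 1 × f v ≢ a) →
    (∀ s → 1 ≤ s → s ≤ n * p + 1 → s ≢ a → ∃ (λ v → f v ≡ s)) →
    HasMagicConstant n p f c →
    ((n * n * p + n + 1) * (p ∸ 1) ≤ 2 * c)
      × (2 * c ≤ (n * n * p + 3 * n ∸ 1) * (p ∸ 1))
mainTheorem6 n p n≥1 p≥1 (_ , ¬index≤np) a a≥1 a≤np f c inj range onto mag =
  magicConstant-bounds n p a w c a≥2 a≤np labelSum (c+w≡p*w⇒c≡[p∸1]*w p c+w≡p*w)
  where
  j₀ = fromℕ< n≥1
  i₀ = fromℕ< p≥1
  w = total f ∸ c
  partSum≡w : ∀ i → partSum f i ≡ w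
  partSum≡w = partSum≡total∸c j₀ mag
  total≡p*w : total f ≡ p * w
  total≡p*w = partSum-constant⇒total≡p*w partSum≡w
  c+w≡p*w : c + w ≡ p * w
  c+w≡p*w = trans (cong (c +_) (sym (partSum≡w i₀))) (trans (c+partSum≡total j₀ mag i₀) total≡p*w)
  labelSum : 2 * (a + p * w) ≡ (n * p + 1) * suc (n * p + 1)
  labelSum = subst (λ t → 2 * (a + t) ≡ _) total≡p*w
    (2*[a+total]≡triangular a≥1 (≤-trans a≤np (m≤m+n (n * p) 1)) inj range onto)
  a≥2 : 2 ≤ a
  a≥2 = missingLabel≥2 ¬index≤np j₀ a≥1 inj range mag
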